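{- Let $f$ be an extended strategy function for a tree $T=(V,E,\omega)$ and let $v\in V$. Let $s_{\min}\in N(v)$ be the vertex screening $v$ whose interval $f(s_{\min})$ is minimal among all vertices screening $v$. Let $f'$ be any function assigning to each vertex $u\in V$ an interval $f'(u)=[a,b)$ with $0\le a<b$ and $|f'(u)|\ge\omega(u)$, satisfying: (1) $f'(u)=f(u)$ for every $u\notin N(v)$; (2) $f'(u)=f(u)$ for every $u\in N(v)$ that screens $v$; (3) $f'(u)<f(s_{\min})$ for every $u\in N(v)$ that does not screen $v$ (including $u=v$). If $f'$ restricted to $N(v)$ is an extended strategy function for the subtree $T[N(v)]$, then $f'$ is an extended strategy function for $T$.
   Context: $T=(V,E,\omega)$ is a tree with $\omega\colon V\to\mathbb{R}_+$. All intervals are of the form $[a,b)$ with integer endpoints, and $|[a,b)|=b-a$. For intervals, $[a,b)>[a',b')$ means $a\ge b'$ and $[a,b)<[a',b')$ means $b\le a'$; $I>I_1\cup I_2$ means $I>I_1$ and $I>I_2$. An interval is minimal in a set of intervals if its left endpoint is at most that of every other interval in the set. An extended strategy function for $T$ is a function $f$ assigning to each vertex $u$ an interval $f(u)=[a,b)$, $0\le a<b$, with $|f(u)|\ge\omega(u)$, such that for every two distinct vertices $v_1,v_2$ with $f(v_1)\cap f(v_2)\ne\emptyset$, the path connecting $v_1$ and $v_2$ contains a vertex $v_3$ with $f(v_3)>f(v_1)\cup f(v_2)$. Given $f$, a vertex $u$ screens $v$ if on the path connecting $v$ and $u$, $u$ is the only vertex $x$ with $f(v)<f(x)$. The screening neighborhood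 $N(v)\subseteq V$ consists of $v$ and all vertices $u$ such that either $u$ screens $v$ or the path connecting $u$ and $v$ contains no vertex screening $v$; $T[N(v)]$ is the subtree induced by $N(v)$. (The statement presupposes that at least one vertex screens $v$.) -}

module Defs where

open import Level using (Level; _⊔_) renaming (suc to lsuc)
open import Data.Nat using (ℕ; _≤_; _<_; _∸_)
open import Data.Fin using (Fin)
open import Data.List using (List; []; _∷_)
open import Data.List.Membership.Propositional using (_∈_)
open import Data.List.Relation.Unary.Unique.Propositional using (Unique)
open import Data.Product using (Σ; ∃; _×_; _,_)
open import Data.Sum using (_⊎_)
open import Relation.Binary.PropositionalEquality using (_≡_)
open import Relation.Nullary using (¬_)

record Interval : Set where
  constructor [_,_⟩⟨_⟩
  field
    lo  : ℕ
    hi  : ℕ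
    lo<hi : lo < hi
open Interval public

len : Interval → ℕ
len I = hi I ∸ lo I

_>ᴵ_ : Interval → Interval → Set
I >ᴵ J = hi J ≤ lo I

_<ᴵ_ : Interval → Interval → Set
I <ᴵ J = hi I ≤ lo J

-- I ∩ J ≠ ∅  (for intervals with integer endpoints: they share an integer point)
Meets : Interval → Interval → Set
Meets I J = ∃ λ k → (lo I ≤ k × k < hi I) × (lo J ≤ k × k < hi J)

module _ {n : ℕ} where

  data Walk (Adj : Fin n → Fin n → Set) : Fin n → Fin n → List (Fin n) → Set where
    here : ∀ {u} → Walk Adj u u (u ∷ [])
    step : ∀ {u w v p} → Adj u w → Walk Adj w v p → Walk Adj u v (u ∷ p)

  IsPath : (Fin n → Fin n → Set) → Fin n → Fin n → List (Fin n) → Set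
  IsPath Adj u v p = Walk Adj u v p × Unique p

record Tree (n : ℕ) : Set₁ where
  field
    Adj        : Fin n → Fin n → Set
    Adj-sym    : ∀ {u v} → Adj u v → Adj v u
    Adj-irrefl : ∀ {u} → ¬ Adj u u
    path-exists : ∀ u v → ∃ λ p → IsPath Adj u v p
    path-unique : ∀ {u v p q} → IsPath Adj u v p → IsPath Adj u v q → p ≡ q
open Tree public

InducedAdj : ∀ {n} → (Fin n → Set) → (Fin n → Fin n → Set) → Fin n → Fin n → Set
InducedAdj S Adj x y = S x × S y × Adj x y

-- Weights ω : V → W take values in an arbitrary type W, with the
-- relation  ω ≤ʷ m  meaning "ω ≤ m" (for the paper, W = ℝ₊ and ≤ʷ the
-- real order with m cast to ℝ).

module _ {W : Set} (_≤ʷ_ : W → ℕ → Set) where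

  IsESF : ∀ {n} → (Fin n → Set) → (Fin n → Fin n → Set) → (Fin n → W)
        → (Fin n → Interval) → Set
  IsESF {n} S Adj ω f =
      (∀ u → S u → ω u ≤ʷ len (f u))
    × (∀ v₁ v₂ → S v₁ → S v₂ → ¬ v₁ ≡ v₂ → Meets (f v₁) (f v₂) →
         ∀ p → IsPath Adj v₁ v₂ p →
         Σ (Fin n) λ v₃ → v₃ ∈ p × (f v₃ >ᴵ f v₁) × (f v₃ >ᴵ f v₂))

Screens : ∀ {n} → Tree n → (Fin n → Interval) → Fin n → Fin n → Set
Screens T f v u =
  ∀ p → IsPath (Adj T) v u p →
    (f v <ᴵ f u) × (∀ x → x ∈ p → f v <ᴵ f x → x ≡ u)

InN : ∀ {n} → Tree n → (Fin n → Interval) → Fin n → Fin n → Set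
InN T f v u =
  u ≡ v ⊎ Screens T f v u
  ⊎ (∀ p → IsPath (Adj T) u v p → ∀ x → x ∈ p → ¬ Screens T f v x)

module Submission where

-- Let f′ v₁ and f′ v₂ meet and let p be the tree path between v₁ and v₂.  If p contains a
-- screener s of v, take the vertex m of p whose f-interval starts last.  As f is an extended
-- strategy function, f m lies above every other f-interval on p.  Since f m starts no earlier
-- than f s, it lies above f v, which no vertex joined to v without crossing a screener can do;
-- so f′ m = f m.  Every other vertex of p keeps its interval or was moved below f smin, which
-- starts no later than f s, so m separates v₁ from v₂ under f′.  If p contains no screener,
-- then, as a non-screening neighbour of an unscreened vertex is unscreened, p lies either
-- entirely in N(v), where f′ is an extended strategy function by hypothesis, or entirely
-- outside N(v), where f′ = f.

open import Defs
open import Data.Nat using (ℕ; _≤_; _≤?_)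
open import Data.Nat.Properties using (≤-refl; ≤-trans; <⇒≱; ≰⇒>)
open import Data.Fin using (Fin)
open import Data.Fin.Properties using (_≟_)
open import Data.List using (List; _∷_; _∷ʳ_; reverse)
open import Data.List.Properties using (unfold-reverse)
open import Data.List.Membership.Propositional using (_∈_; find; lose)
open import Data.List.Relation.Binary.Subset.Propositional using (_⊆_)
open import Data.List.Relation.Binary.Subset.Propositional.Properties using (∷⁺ʳ; ∈-∷⁺ʳ)
open import Data.List.Relation.Unary.Any as Any using (Any; here; there)
open import Data.List.Relation.Unary.Any.Properties using (reverse⁺; reverse⁻)
open import Data.List.Relation.Unary.All as All using (All; []; _∷_)
open import Data.List.Relation.Unary.All.Properties using (anti-mono; ¬Any⇒All¬)
open import Data.List.Relation.Unary.AllPairs using ([]; _∷_)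
import Data.List.Relation.Binary.Permutation.Setoid as Permutation
import Data.List.Relation.Binary.Permutation.Setoid.Properties as PermutationProperties
open import Data.List.Extrema.Nat using (argmax; argmax-sel; f[xs]≤f[argmax])
open import Data.Product using (Σ; ∃; ∃₂; _×_; _,_; proj₁; proj₂)
open import Data.Sum using (_⊎_; inj₁; inj₂; [_,_]′)
open import Data.Unit using (⊤; tt)
open import Data.Empty using (⊥-elim)
open import Function using (_∘_; id)
open import Relation.Binary.PropositionalEquality using (_≡_; _≢_; refl; sym; subst; subst₂; setoid)
open import Relation.Nullary using (¬_; ¬?; yes; no; contradiction)
open import Relation.Nullary.Decidable using (map′; _×-dec_; _→-dec_)
open import Relation.Unary using (Decidable)

<ᴵ-irrefl : ∀ I → ¬ (I <ᴵ I)
<ᴵ-irrefl I = <⇒≱ (lo<hi I)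

Meets-sym : ∀ {I J} → Meets I J → Meets J I
Meets-sym (k , k∈I , k∈J) = k , k∈J , k∈I

Meets⇒¬>ᴵ : ∀ {I J} → Meets I J → ¬ (I >ᴵ J)
Meets⇒¬>ᴵ (k , (lo-I≤k , _) , (_ , k<hi-J)) hi-J≤lo-I = <⇒≱ k<hi-J (≤-trans hi-J≤lo-I lo-I≤k)

¬<ᴵ⇒Meets : ∀ {I J} → lo I ≤ lo J → ¬ (I <ᴵ J) → Meets I J
¬<ᴵ⇒Meets {I} {J} lo-I≤lo-J ¬I<J = lo J , (lo-I≤lo-J , ≰⇒> ¬I<J) , (≤-refl , lo<hi J)

module _ {n : ℕ} {E : Fin n → Fin n → Set} where

  walk-start : ∀ {u w p} → Walk E u w p → u ∈ p
  walk-start here       = here refl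
  walk-start (step _ _) = here refl

  walk-end : ∀ {u w p} → Walk E u w p → w ∈ p
  walk-end here       = here refl
  walk-end (step _ W) = there (walk-end W)

  walk-induced : ∀ {S : Fin n → Set} {u w p} → Walk E u w p → All S p → Walk (InducedAdj S E) u w p
  walk-induced here       _            = here
  walk-induced (step e W) (Su ∷ S-rest) =
    step (Su , All.lookup S-rest (walk-start W) , e) (walk-induced W S-rest)

  path-cons : ∀ {u x y p q} → E u x → All (u ≢_) p → IsPath E x y q → q ⊆ p → IsPath E u y (u ∷ q)
  path-cons e u∉p (W , U) q⊆p = step e W , anti-mono q⊆p u∉p ∷ U

  path-prefix : ∀ {u w x p} → IsPath E u w p → x ∈ p → ∃ λ q → IsPath E u x q × q ⊆ p
  path-prefix (here , _)     (here refl) = _ , (here , [] ∷ []) , id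
  path-prefix (step _ _ , _) (here refl) = _ , (here , [] ∷ []) , ∈-∷⁺ʳ (here refl) (λ ())
  path-prefix (here , _)     (there ())
  path-prefix (step e W , u∉p ∷ U) (there x∈p) with path-prefix (W , U) x∈p
  ... | q , pq , q⊆p = _ , path-cons e u∉p pq q⊆p , ∷⁺ʳ _ q⊆p

  first-on-path : ∀ {Q : Fin n → Set} → Decidable Q → ∀ {u w p} → IsPath E u w p → Any Q p →
    ∃₂ λ y q → IsPath E u y q × q ⊆ p × Q y × (∀ {z} → z ∈ q → Q z → z ≡ y)
  first-on-path Q? {u} (W , U) Qp with Q? u
  ... | yes Qu =
    u , _ , (here , [] ∷ []) , ∈-∷⁺ʳ (walk-start W) (λ ()) , Qu , λ { (here refl) _ → refl }
  first-on-path Q? (here , _)            (here Qu)  | no ¬Qu = contradiction Qu ¬Qu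
  first-on-path Q? (step _ _ , _)        (here Qu)  | no ¬Qu = contradiction Qu ¬Qu
  first-on-path Q? (step e W , u∉p ∷ U) (there Qp) | no ¬Qu with first-on-path Q? (W , U) Qp
  ... | y , q , pq , q⊆p , Qy , first = y , _ , path-cons e u∉p pq q⊆p , ∷⁺ʳ _ q⊆p , Qy ,
    λ { (here refl) Qu → contradiction Qu ¬Qu ; (there z∈q) → first z∈q }

  module _ (E-sym : ∀ {u w} → E u w → E w u) where

    walk-∷ʳ : ∀ {u w x p} → Walk E u w p → E w x → Walk E u x (p ∷ʳ x)
    walk-∷ʳ here       e = step e here
    walk-∷ʳ (step d W) e = step d (walk-∷ʳ W e)

    walk-reverse : ∀ {u w p} → Walk E u w p → Walk E w u (reverse p)
    walk-reverse here                   = here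
    walk-reverse (step {u} {p = p} e W) =
      subst (Walk E _ u) (sym (unfold-reverse u p)) (walk-∷ʳ (walk-reverse W) (E-sym e))

    path-reverse : ∀ {u w p} → IsPath E u w p → IsPath E w u (reverse p)
    path-reverse {p = p} (W , U) =
      walk-reverse W , Unique-resp-↭ (↭-sym (↭-reverse p)) U
      where open Permutation (setoid (Fin n)) using (↭-sym)
            open PermutationProperties (setoid (Fin n)) using (Unique-resp-↭; ↭-reverse)

    path-segment : ∀ {u w x y p} → IsPath E u w p → x ∈ p → y ∈ p → ∃ λ q → IsPath E x y q × q ⊆ p
    path-segment (here , _) (here refl) (here refl) = _ , (here , [] ∷ []) , id
    path-segment (here , _) (there ()) _
    path-segment (here , _) _ (there ())
    path-segment P@(step _ _ , _) (here refl) y∈p = path-prefix P y∈p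
    path-segment P@(step _ _ , _) x∈p@(there _) (here refl) with path-prefix P x∈p
    ... | q , pq , q⊆p = reverse q , path-reverse pq , q⊆p ∘ reverse⁻
    path-segment (step _ W , _ ∷ U) (there x∈p) (there y∈p) with path-segment (W , U) x∈p y∈p
    ... | q , pq , q⊆p = q , pq , there ∘ q⊆p

Separates : ∀ {n} → (Fin n → Interval) → List (Fin n) → Fin n → Fin n → Set
Separates {n} g p v₁ v₂ = Σ (Fin n) λ v₃ → v₃ ∈ p × (g v₃ >ᴵ g v₁) × (g v₃ >ᴵ g v₂)

peak-separates : ∀ {n} {g : Fin n → Interval} {p v₁ v₂ m} → v₁ ≢ v₂ → Meets (g v₁) (g v₂) →
  v₁ ∈ p → v₂ ∈ p → m ∈ p → (∀ {x} → x ∈ p → x ≢ m → g m >ᴵ g x) → Separates g p v₁ v₂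
peak-separates {g = g} {v₁ = v₁} {v₂} {m} v₁≢v₂ meet v₁∈p v₂∈p m∈p peak with v₁ ≟ m | v₂ ≟ m
... | yes refl | yes refl = contradiction refl v₁≢v₂
... | yes refl | no v₂≢m  = contradiction (peak v₂∈p v₂≢m) (Meets⇒¬>ᴵ {g v₁} {g v₂} meet)
... | no v₁≢m  | yes refl =
  contradiction (peak v₁∈p v₁≢m) (Meets⇒¬>ᴵ {g v₂} {g v₁} (Meets-sym {g v₁} {g v₂} meet))
... | no v₁≢m  | no v₂≢m  = m , m∈p , peak v₁∈p v₁≢m , peak v₂∈p v₂≢m

-- An f-interval on p overlapping f m would need a separating vertex of p starting above f m.
peak-dominates : ∀ {W : Set} {_≤ʷ_ : W → ℕ → Set} {n} {E : Fin n → Fin n → Set} {ω f} →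
  (∀ {u w} → E u w → E w u) → IsESF _≤ʷ_ (λ _ → ⊤) E ω f →
  ∀ {u w p m} → IsPath E u w p → m ∈ p → (∀ {x} → x ∈ p → lo (f x) ≤ lo (f m)) →
  ∀ {x} → x ∈ p → x ≢ m → f m >ᴵ f x
peak-dominates {f = f} E-sym (_ , separated) {m = m} pp m∈p m-max {x} x∈p x≢m
  with hi (f x) ≤? lo (f m)
... | yes below = below
... | no ¬below with path-segment E-sym pp x∈p m∈p
... | q , pq , q⊆p with separated x m tt tt x≢m (¬<ᴵ⇒Meets {f x} {f m} (m-max x∈p) ¬below) q pq
... | z , z∈q , _ , z>m = ⊥-elim (<ᴵ-irrefl (f m) (≤-trans z>m (m-max (q⊆p z∈q))))

Unscreened : ∀ {n} → Tree n → (Fin n → Interval) → Fin n → Fin n → Set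
Unscreened T f v u = ∀ p → IsPath (Adj T) u v p → ∀ x → x ∈ p → ¬ Screens T f v x

module Screening {n : ℕ} (T : Tree n) (f : Fin n → Interval) (v : Fin n) where

  open import Data.List.Membership.DecPropositional (_≟_ {n}) using (_∈?_)

  screens-via : ∀ {u p} → IsPath (Adj T) v u p → f v <ᴵ f u → (∀ {x} → x ∈ p → f v <ᴵ f x → x ≡ u) →
                Screens T f v u
  screens-via pp above only q pq rewrite path-unique T pq pp = above , λ _ → only

  unscreened-via : ∀ {u p} → IsPath (Adj T) u v p → (∀ {x} → x ∈ p → ¬ Screens T f v x) →
                   Unscreened T f v u
  unscreened-via pp clear q pq rewrite path-unique T pq pp = λ _ → clear

  screens⇒above : ∀ {s} → Screens T f v s → f v <ᴵ f s
  screens⇒above {s} scr = proj₁ (scr _ (proj₂ (path-exists T v s)))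

  screens? : Decidable (Screens T f v)
  screens? u with path-exists T v u
  ... | p , pp = map′ (λ (above , only) → screens-via pp above (All.lookup only))
                      (λ scr → proj₁ (scr p pp) , All.tabulate (proj₂ (scr p pp) _))
                      ((hi (f v) ≤? lo (f u))
                        ×-dec All.all? (λ x → (hi (f v) ≤? lo (f x)) →-dec (x ≟ u)) p)

  unscreened? : Decidable (Unscreened T f v)
  unscreened? u with path-exists T u v
  ... | p , pp = map′ (λ clear → unscreened-via pp (All.lookup clear))
                      (λ d → All.tabulate (d p pp _))
                      (All.all? (λ x → ¬? (screens? x)) p)

  unscreened⇒¬screens : ∀ {u} → Unscreened T f v u → ¬ Screens T f v u
  unscreened⇒¬screens {u} d with path-exists T u v
  ... | p , pp = d p pp u (walk-start (proj₁ pp))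

  -- The first vertex above f v on the path from v to x would screen v.
  unscreened⇒¬above : ∀ {x} → Unscreened T f v x → ¬ (f v <ᴵ f x)
  unscreened⇒¬above {x} d above with path-exists T v x
  ... | p , pp with first-on-path (λ z → hi (f v) ≤? lo (f z)) pp (lose (walk-end (proj₁ pp)) above)
  ... | y , q , pq , q⊆p , y-above , first =
    d (reverse p) (path-reverse (Adj-sym T) pp) y (reverse⁺ (q⊆p (walk-end (proj₁ pq))))
      (screens-via pq y-above first)

  unscreened-self : Unscreened T f v v
  unscreened-self = unscreened-via (here , [] ∷ [])
    λ { (here refl) scr → <ᴵ-irrefl (f v) (screens⇒above scr) }

  ∉N : ∀ {u} → ¬ Screens T f v u → ¬ Unscreened T f v u → ¬ InN T f v u
  ∉N _   ¬d (inj₁ refl)        = ¬d unscreened-self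
  ∉N ¬s  _  (inj₂ (inj₁ scr))  = ¬s scr
  ∉N _   ¬d (inj₂ (inj₂ d))    = ¬d d

  unscreened-step : ∀ {x y} → Adj T y x → Unscreened T f v x → ¬ Screens T f v y →
                    Unscreened T f v y
  unscreened-step {x} {y} e d ¬scr with path-exists T x v
  ... | p , pp@(W , U) with y ∈? p
  ... | yes y∈p = let q , pq , q⊆p = path-segment (Adj-sym T) pp y∈p (walk-end W)
                  in unscreened-via pq (λ z∈q → d p pp _ (q⊆p z∈q))
  ... | no  y∉p = unscreened-via (step e W , ¬Any⇒All¬ p y∉p ∷ U)
                    λ { (here refl) → ¬scr ; (there z∈p) → d p pp _ z∈p }

  unscreened-along : ∀ {a b p} → Walk (Adj T) a b p → All (¬_ ∘ Screens T f v) p →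
                     Any (Unscreened T f v) p → All (Unscreened T f v) p
  unscreened-along here       _            (here d)  = d ∷ []
  unscreened-along (step e W) (_ ∷ ¬scrs)  (here d)  =
    d ∷ unscreened-along W ¬scrs
          (lose (walk-start W) (unscreened-step (Adj-sym T e) d (All.lookup ¬scrs (walk-start W))))
  unscreened-along (step e W) (¬scr ∷ ¬scrs) (there k) with unscreened-along W ¬scrs k
  ... | ds = unscreened-step e (All.lookup ds (walk-start W)) ¬scr ∷ ds

module Replacement {Weight : Set} (_≤ʷ_ : Weight → ℕ → Set) {n : ℕ} (T : Tree n)
    (ω : Fin n → Weight) (f : Fin n → Interval) (f-esf : IsESF _≤ʷ_ (λ _ → ⊤) (Adj T) ω f)
    (v smin : Fin n) (smin-least : ∀ s → Screens T f v s → lo (f smin) ≤ lo (f s))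
    (f′ : Fin n → Interval)
    (fixed-outside : ∀ u → ¬ InN T f v u → f′ u ≡ f u)
    (fixed-screeners : ∀ u → InN T f v u → Screens T f v u → f′ u ≡ f u)
    (below-smin : ∀ u → InN T f v u → ¬ Screens T f v u → f′ u <ᴵ f smin)
    (f′-esf-N : IsESF _≤ʷ_ (InN T f v) (InducedAdj (InN T f v) (Adj T)) ω f′) where

  open Screening T f v

  f′-fixed : ∀ {x} → ¬ Unscreened T f v x → f′ x ≡ f x
  f′-fixed {x} ¬d with screens? x
  ... | yes scr = fixed-screeners x (inj₂ (inj₁ scr)) scr
  ... | no ¬scr = fixed-outside x (∉N ¬scr ¬d)

  f′-fixed-or-low : ∀ x → f′ x ≡ f x ⊎ f′ x <ᴵ f smin
  f′-fixed-or-low x with unscreened? x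
  ... | yes d  = inj₂ (below-smin x (inj₂ (inj₂ d)) (unscreened⇒¬screens d))
  ... | no ¬d  = inj₁ (f′-fixed ¬d)

  separated-across-screener : ∀ {v₁ v₂ p s} → v₁ ≢ v₂ → Meets (f′ v₁) (f′ v₂) →
                              IsPath (Adj T) v₁ v₂ p → s ∈ p → Screens T f v s →
                              Separates f′ p v₁ v₂
  separated-across-screener {v₁} {p = p} {s} v₁≢v₂ meet pp@(W , _) s∈p s-scr =
    peak-separates {g = f′} v₁≢v₂ meet (walk-start W) (walk-end W) m∈p f′-peak
    where
    m : Fin n
    m = argmax (lo ∘ f) v₁ p

    m∈p : m ∈ p
    m∈p = [ (λ m≡v₁ → subst (_∈ p) (sym m≡v₁) (walk-start W)) , id ]′ (argmax-sel (lo ∘ f) v₁ p)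

    m-max : ∀ {x} → x ∈ p → lo (f x) ≤ lo (f m)
    m-max = All.lookup (f[xs]≤f[argmax] v₁ p)

    smin≤m : lo (f smin) ≤ lo (f m)
    smin≤m = ≤-trans (smin-least s s-scr) (m-max s∈p)

    m-fixed : f′ m ≡ f m
    m-fixed = f′-fixed λ d → unscreened⇒¬above d (≤-trans (screens⇒above s-scr) (m-max s∈p))

    f′-peak : ∀ {x} → x ∈ p → x ≢ m → f′ m >ᴵ f′ x
    f′-peak {x} x∈p x≢m rewrite m-fixed with f′-fixed-or-low x
    ... | inj₁ x-fixed rewrite x-fixed =
      peak-dominates {_≤ʷ_ = _≤ʷ_} {ω = ω} {f = f} (Adj-sym T) f-esf pp m∈p m-max x∈p x≢m
    ... | inj₂ x-low = ≤-trans x-low smin≤m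

  separated-inside-N : ∀ {v₁ v₂ p} → v₁ ≢ v₂ → Meets (f′ v₁) (f′ v₂) → IsPath (Adj T) v₁ v₂ p →
                       All (Unscreened T f v) p → Separates f′ p v₁ v₂
  separated-inside-N {v₁} {v₂} {p} v₁≢v₂ meet (W , U) ds =
    proj₂ f′-esf-N v₁ v₂ (All.lookup inN (walk-start W)) (All.lookup inN (walk-end W)) v₁≢v₂ meet p
      (walk-induced W inN , U)
    where
    inN : All (InN T f v) p
    inN = All.map (λ d → inj₂ (inj₂ d)) ds

  separated-outside-N : ∀ {v₁ v₂ p} → v₁ ≢ v₂ → Meets (f′ v₁) (f′ v₂) → IsPath (Adj T) v₁ v₂ p →
                        (∀ {x} → x ∈ p → ¬ Unscreened T f v x) → Separates f′ p v₁ v₂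
  separated-outside-N {v₁} {v₂} {p} v₁≢v₂ meet pp@(W , _) ¬ds =
    transport (proj₂ f-esf v₁ v₂ tt tt v₁≢v₂ meet-f p pp)
    where
    fixed : ∀ {x} → x ∈ p → f′ x ≡ f x
    fixed = f′-fixed ∘ ¬ds

    meet-f : Meets (f v₁) (f v₂)
    meet-f = subst₂ Meets (fixed (walk-start W)) (fixed (walk-end W)) meet

    transport : Separates f p v₁ v₂ → Separates f′ p v₁ v₂
    transport (z , z∈p , z>v₁ , z>v₂) =
      z , z∈p , subst₂ _>ᴵ_ (sym (fixed z∈p)) (sym (fixed (walk-start W))) z>v₁
              , subst₂ _>ᴵ_ (sym (fixed z∈p)) (sym (fixed (walk-end W))) z>v₂

lemma11 : {W : Set} (_≤ʷ_ : W → ℕ → Set) {n : ℕ} (T : Tree n) (ω : Fin n → W)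
    (f : Fin n → Interval) → IsESF _≤ʷ_ (λ _ → ⊤) (Adj T) ω f →
    (v smin : Fin n) → Screens T f v smin →
    (∀ s → Screens T f v s → lo (f smin) ≤ lo (f s)) →
    (f′ : Fin n → Interval) → (∀ u → ω u ≤ʷ len (f′ u)) →
    (∀ u → ¬ InN T f v u → f′ u ≡ f u) →
    (∀ u → InN T f v u → Screens T f v u → f′ u ≡ f u) →
    (∀ u → InN T f v u → ¬ Screens T f v u → f′ u <ᴵ f smin) →
    IsESF _≤ʷ_ (InN T f v) (InducedAdj (InN T f v) (Adj T)) ω f′ →
    IsESF _≤ʷ_ (λ _ → ⊤) (Adj T) ω f′
lemma11 _≤ʷ_ T ω f f-esf v smin _ smin-least f′ f′-weights
        fixed-outside fixed-screeners below-smin f′-esf-N =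
  (λ u _ → f′-weights u) , separated
  where
  open Screening T f v
  open Replacement _≤ʷ_ T ω f f-esf v smin smin-least f′
                   fixed-outside fixed-screeners below-smin f′-esf-N

  separated : ∀ v₁ v₂ → ⊤ → ⊤ → v₁ ≢ v₂ → Meets (f′ v₁) (f′ v₂) →
              ∀ p → IsPath (Adj T) v₁ v₂ p → Separates f′ p v₁ v₂
  separated v₁ v₂ _ _ v₁≢v₂ meet p pp with Any.any? screens? p | Any.any? unscreened? p
  ... | yes scr∈p | _ =
    let s , s∈p , s-scr = find scr∈p in separated-across-screener v₁≢v₂ meet pp s∈p s-scr
  ... | no ¬scr∈p | yes d∈p =
    separated-inside-N v₁≢v₂ meet pp (unscreened-along (proj₁ pp) (¬Any⇒All¬ p ¬scr∈p) d∈p)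
  ... | no _      | no ¬d∈p = separated-outside-N v₁≢v₂ meet pp (λ x∈p d → ¬d∈p (lose x∈p d))
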